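{- Let $L$ be a complete Boolean algebra. Then the change action $\hat L_{\bowtie}$ is continuous: $L$ and $L\bowtie L$ (with the order $(p,q)\le(r,s)\iff p\le r\text{ and }q\ge s$) are directed-complete partial orders, and $\oplus_{\bowtie}:L\times(L\bowtie L)\to L$ and $\bowtie:(L\bowtie L)\times(L\bowtie L)\to L\bowtie L$ are continuous.
   Context: $\hat L_{\bowtie}$ is the change action with base $L$, change set $L\bowtie L=\{(p,q)\in L\times L\mid p\wedge q=\bot\}$, monoid operation $(p,q)\bowtie(r,s)=((p\wedge\neg s)\vee r,(q\wedge\neg r)\vee s)$ with identity $(\bot,\bot)$, and action $a\oplus_{\bowtie}(p,q)=(a\vee p)\wedge\neg q$. A directed-complete partial order (dcpo) is a poset in which every non-empty directed subset has a least upper bound; a function between dcpos is continuous if it is monotone and preserves least upper bounds of directed subsets (products carry the componentwise order). -}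

module Defs where

open import Level using (Level; _⊔_; suc)
open import Data.Product using (Σ; ∃; _×_; _,_; proj₁; proj₂)
open import Relation.Binary.Core using (Rel)
open import Relation.Unary using (Pred; _∈_)
open import Algebra.Lattice.Bundles using (BooleanAlgebra)

module _ {a r : Level} {A : Set a} (_≤_ : Rel A r) where

  IsUpperBound : ∀ {s} → Pred A s → A → Set (a ⊔ r ⊔ s)
  IsUpperBound D u = ∀ {x} → x ∈ D → x ≤ u

  IsLub : ∀ {s} → Pred A s → A → Set (a ⊔ r ⊔ s)
  IsLub D u = IsUpperBound D u × (∀ v → IsUpperBound D v → u ≤ v)

  NonEmpty : ∀ {s} → Pred A s → Set (a ⊔ s)
  NonEmpty D = ∃ λ x → x ∈ D

  Directed : ∀ {s} → Pred A s → Set (a ⊔ r ⊔ s)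
  Directed D = NonEmpty D ×
    (∀ {x y} → x ∈ D → y ∈ D → ∃ λ z → z ∈ D × (x ≤ z) × (y ≤ z))

  DirectedComplete : (s : Level) → Set (a ⊔ r ⊔ suc s)
  DirectedComplete s = (D : Pred A s) → Directed D → ∃ λ u → IsLub D u

module _ {a r b t : Level} {A : Set a} {B : Set b}
         (_≤A_ : Rel A r) (_≤B_ : Rel B t) where

  Monotone : (A → B) → Set (a ⊔ r ⊔ t)
  Monotone f = ∀ {x y} → x ≤A y → f x ≤B f y

  IsLubOfImage : ∀ {s} → (A → B) → Pred A s → B → Set (a ⊔ b ⊔ t ⊔ s)
  IsLubOfImage f D v =
    (∀ {d} → d ∈ D → f d ≤B v) ×
    (∀ w → (∀ {d} → d ∈ D → f d ≤B w) → v ≤B w)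

  Continuous : (s : Level) → (A → B) → Set (a ⊔ b ⊔ r ⊔ t ⊔ suc s)
  Continuous s f = Monotone f ×
    ((D : Pred A s) → Directed _≤A_ D → ∀ u → IsLub _≤A_ D u → IsLubOfImage f D (f u))

_×ᵣ_ : ∀ {a b r t} {A : Set a} {B : Set b} → Rel A r → Rel B t → Rel (A × B) (r ⊔ t)
(R ×ᵣ T) (x₁ , y₁) (x₂ , y₂) = R x₁ x₂ × T y₁ y₂

module BA {c ℓ} (B : BooleanAlgebra c ℓ) where
  open BooleanAlgebra B

  _≤_ : Rel Carrier ℓ
  x ≤ y = (x ∧ y) ≈ x

record CompleteBooleanAlgebra (c ℓ : Level) : Set (suc (c ⊔ ℓ)) where
  field
    booleanAlgebra : BooleanAlgebra c ℓ
  open BooleanAlgebra booleanAlgebra public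
  open BA booleanAlgebra public
  field
    ⋁       : Pred Carrier (c ⊔ ℓ) → Carrier
    ⋁-isLub : (S : Pred Carrier (c ⊔ ℓ)) → IsLub _≤_ S (⋁ S)

module Bowtie {c ℓ} (L : CompleteBooleanAlgebra c ℓ) where
  open CompleteBooleanAlgebra L

  L⋈L : Set (c ⊔ ℓ)
  L⋈L = Σ (Carrier × Carrier) λ pq → (proj₁ pq ∧ proj₂ pq) ≈ ⊥

  _≈⋈_ : Rel L⋈L ℓ
  ((p , q) , _) ≈⋈ ((r , s′) , _) = (p ≈ r) × (q ≈ s′)

  _≤⋈_ : Rel L⋈L ℓ
  ((p , q) , _) ≤⋈ ((r , s′) , _) = (p ≤ r) × (s′ ≤ q)

  _⋈ʳ_ : Carrier × Carrier → Carrier × Carrier → Carrier × Carrier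
  (p , q) ⋈ʳ (r , s′) = ((p ∧ ¬ s′) ∨ r) , ((q ∧ ¬ r) ∨ s′)

  _⊕⋈_ : Carrier → L⋈L → Carrier
  a ⊕⋈ ((p , q) , _) = (a ∨ p) ∧ ¬ q

  -- closure of L ⋈ L under ⋈ (needed to view ⋈ as a map L⋈L × L⋈L → L⋈L)
  ⋈-Closed : Set (c ⊔ ℓ)
  ⋈-Closed = (x y : L⋈L) → (proj₁ (proj₁ x ⋈ʳ proj₁ y) ∧ proj₂ (proj₁ x ⋈ʳ proj₁ y)) ≈ ⊥

  bowtie : ⋈-Closed → L⋈L × L⋈L → L⋈L
  bowtie cl (x , y) = (proj₁ x ⋈ʳ proj₁ y) , cl x y

-- The map (p , q) ↦ (p , ¬ q) embeds L ⋈ L into L × L, ordered componentwise, as the pairs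
-- (p , n) with p ≤ n. In these coordinates a ⊕⋈ (p , n) = (a ∨ p) ∧ n and
-- (p , n) ⋈ (p′ , n′) = ((p ∧ n′) ∨ p′ , (n ∨ p′) ∧ n′) are lattice polynomials, and suprema
-- are computed componentwise. Joins commute with all suprema, and meets with directed ones:
-- a complete Boolean algebra is infinitely distributive, so ⋁ f ∧ ⋁ g = ⋁ᵢⱼ (f i ∧ g j), and
-- by directedness each f i ∧ g j lies below some f k ∧ g k.
module Submission where

open import Defs
open import Level using (Level; _⊔_)
open import Data.Product using (Σ; ∃; _×_; uncurry; _,_; proj₁; proj₂)
open import Function using (_∘_; _$_; id)
open import Relation.Binary.Core using (Rel)
open import Relation.Binary.Structures using (IsPartialOrder)
open import Relation.Unary using (Pred; _∈_)
open import Algebra.Lattice.Bundles using (BooleanAlgebra)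
import Algebra.Lattice.Properties.BooleanAlgebra as BooleanAlgebraProperties
import Algebra.Lattice.Properties.Lattice as LatticeProperties
import Relation.Binary.Lattice as OrderLattice
import Relation.Binary.Lattice.Properties.JoinSemilattice as JoinSemilatticeProperties
import Relation.Binary.Lattice.Properties.MeetSemilattice as MeetSemilatticeProperties
import Relation.Binary.Reasoning.PartialOrder as ≤-Reasoning

module BooleanOrder {c ℓ} (B : BooleanAlgebra c ℓ) where
  open BooleanAlgebra B
  open BA B using (_≤_)
  open BooleanAlgebraProperties B
    using (∧-identityʳ; ∨-identityˡ; ∨-identityʳ; ∧-zeroʳ; ¬-involutive; deMorgan₁; deMorgan₂)

  -- The library orders a lattice by x ≈ x ∧ y; ours is the symmetric form x ∧ y ≈ x.
  private
    module Natural = OrderLattice.IsLattice (LatticeProperties.∨-∧-isOrderTheoreticLattice lattice)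

  ≤-isLattice : OrderLattice.IsLattice _≈_ _≤_ _∨_ _∧_
  ≤-isLattice = record
    { isPartialOrder = record
      { isPreorder = record
        { isEquivalence = isEquivalence
        ; reflexive     = λ x≈y → sym (Natural.reflexive x≈y)
        ; trans         = λ x≤y y≤z → sym (Natural.trans (sym x≤y) (sym y≤z))
        }
      ; antisym = λ x≤y y≤x → Natural.antisym (sym x≤y) (sym y≤x)
      }
    ; supremum = λ x y → sym (Natural.x≤x∨y x y) , sym (Natural.y≤x∨y x y) ,
                         λ z x≤z y≤z → sym (Natural.∨-least (sym x≤z) (sym y≤z))
    ; infimum  = λ x y → sym (Natural.x∧y≤x x y) , sym (Natural.x∧y≤y x y) ,
                         λ z z≤x z≤y → sym (Natural.∧-greatest (sym z≤x) (sym z≤y))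
    }

  ≤-lattice : OrderLattice.Lattice c ℓ ℓ
  ≤-lattice = record { isLattice = ≤-isLattice }

  open OrderLattice.Lattice ≤-lattice public
    using (poset; isPartialOrder; x≤x∨y; y≤x∨y; ∨-least; x∧y≤x; x∧y≤y; ∧-greatest)
    renaming (refl to ≤-refl; reflexive to ≤-reflexive; trans to ≤-trans; antisym to ≤-antisym)
  open JoinSemilatticeProperties (OrderLattice.Lattice.joinSemilattice ≤-lattice) public
    using (∨-monotonic)
  open MeetSemilatticeProperties (OrderLattice.Lattice.meetSemilattice ≤-lattice) public
    using (∧-monotonic)
  open ≤-Reasoning poset

  x≤⊥⇒x≈⊥ : ∀ {x} → x ≤ ⊥ → x ≈ ⊥
  x≤⊥⇒x≈⊥ {x} x≤⊥ = trans (sym x≤⊥) (∧-zeroʳ x)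

  x∧y≤z⇒x≤¬y∨z : ∀ {x y z} → (x ∧ y) ≤ z → x ≤ (¬ y ∨ z)
  x∧y≤z⇒x≤¬y∨z {x} {y} {z} x∧y≤z = begin
    x                    ≈⟨ ∧-identityʳ x ⟨
    x ∧ ⊤                ≈⟨ ∧-congˡ (∨-complementʳ y) ⟨
    x ∧ (y ∨ ¬ y)        ≈⟨ ∧-distribˡ-∨ x y (¬ y) ⟩
    (x ∧ y) ∨ (x ∧ ¬ y)  ≤⟨ ∨-monotonic x∧y≤z (x∧y≤y x (¬ y)) ⟩
    z ∨ ¬ y              ≈⟨ ∨-comm z (¬ y) ⟩
    ¬ y ∨ z              ∎

  x≤¬y∨z⇒x∧y≤z : ∀ {x y z} → x ≤ (¬ y ∨ z) → (x ∧ y) ≤ z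
  x≤¬y∨z⇒x∧y≤z {x} {y} {z} x≤¬y∨z = begin
    x ∧ y                ≤⟨ ∧-monotonic x≤¬y∨z ≤-refl ⟩
    (¬ y ∨ z) ∧ y        ≈⟨ ∧-distribʳ-∨ y (¬ y) z ⟩
    (¬ y ∧ y) ∨ (z ∧ y)  ≈⟨ ∨-congʳ (∧-complementˡ y) ⟩
    ⊥ ∨ (z ∧ y)          ≈⟨ ∨-identityˡ (z ∧ y) ⟩
    z ∧ y                ≤⟨ x∧y≤x z y ⟩
    z                    ∎

  x∧y≈⊥⇒x≤¬y : ∀ {x y} → (x ∧ y) ≈ ⊥ → x ≤ (¬ y)
  x∧y≈⊥⇒x≤¬y {x} {y} x∧y≈⊥ =
    ≤-trans (x∧y≤z⇒x≤¬y∨z (≤-reflexive x∧y≈⊥)) (≤-reflexive (∨-identityʳ (¬ y)))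

  x≤¬y⇒x∧y≈⊥ : ∀ {x y} → x ≤ (¬ y) → (x ∧ y) ≈ ⊥
  x≤¬y⇒x∧y≈⊥ {x} {y} x≤¬y =
    x≤⊥⇒x≈⊥ (x≤¬y∨z⇒x∧y≤z (≤-trans x≤¬y (≤-reflexive (sym (∨-identityʳ (¬ y))))))

  ¬-antitone : ∀ {x y} → x ≤ y → (¬ y) ≤ (¬ x)
  ¬-antitone {x} {y} x≤y = x∧y≈⊥⇒x≤¬y (x≤⊥⇒x≈⊥ (begin
    ¬ y ∧ x  ≤⟨ ∧-monotonic ≤-refl x≤y ⟩
    ¬ y ∧ y  ≈⟨ ∧-complementˡ y ⟩
    ⊥        ∎))

  x≤¬y⇒y≤¬x : ∀ {x y} → x ≤ (¬ y) → y ≤ (¬ x)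
  x≤¬y⇒y≤¬x {x} {y} x≤¬y = begin
    y      ≈⟨ ¬-involutive y ⟨
    ¬ ¬ y  ≤⟨ ¬-antitone x≤¬y ⟩
    ¬ x    ∎

  ¬x≤y⇒¬y≤x : ∀ {x y} → (¬ x) ≤ y → (¬ y) ≤ x
  ¬x≤y⇒¬y≤x {x} {y} ¬x≤y = begin
    ¬ y    ≤⟨ ¬-antitone ¬x≤y ⟩
    ¬ ¬ x  ≈⟨ ¬-involutive x ⟩
    x      ∎

  ¬x≤¬y⇒y≤x : ∀ {x y} → (¬ x) ≤ (¬ y) → y ≤ x
  ¬x≤¬y⇒y≤x {x} {y} ¬x≤¬y = ≤-trans (x≤¬y⇒y≤¬x ¬x≤¬y) (≤-reflexive (¬-involutive x))

  ¬[x∧¬y∨z]≈[¬x∨y]∧¬z : ∀ x y z → (¬ ((x ∧ ¬ y) ∨ z)) ≈ ((¬ x ∨ y) ∧ ¬ z)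
  ¬[x∧¬y∨z]≈[¬x∨y]∧¬z x y z = trans (deMorgan₂ (x ∧ ¬ y) z)
    (∧-congʳ (trans (deMorgan₁ x (¬ y)) (∨-congˡ (¬-involutive y))))

module Continuity {c ℓ} (L : CompleteBooleanAlgebra c ℓ) where
  open CompleteBooleanAlgebra L
  open BooleanOrder booleanAlgebra
  open BooleanAlgebraProperties booleanAlgebra using (¬-involutive)
  open Bowtie L
  open ≤-Reasoning poset

  module _ {X : Set (c ⊔ ℓ)} where

    sup : Pred X (c ⊔ ℓ) → (X → Carrier) → Carrier
    sup D f = ⋁ λ y → ∃ λ x → x ∈ D × f x ≈ y

    sup-ub : ∀ {D f x} → x ∈ D → f x ≤ sup D f
    sup-ub x∈D = proj₁ (⋁-isLub _) (_ , x∈D , refl)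

    sup-least : ∀ {D f t} → (∀ {x} → x ∈ D → f x ≤ t) → sup D f ≤ t
    sup-least {t = t} bound =
      proj₂ (⋁-isLub _) t λ (_ , x∈D , fx≈y) → ≤-trans (≤-reflexive (sym fx≈y)) (bound x∈D)

    sup-mono : ∀ {D f g} → (∀ {x} → x ∈ D → f x ≤ g x) → sup D f ≤ sup D g
    sup-mono f≤g = sup-least λ x∈D → ≤-trans (f≤g x∈D) (sup-ub x∈D)

    -- Infinite distributivity, obtained by residuating along _ ∧ y ⊣ ¬ y ∨ _.
    sup-∧-least : ∀ {D f y t} → (∀ {x} → x ∈ D → (f x ∧ y) ≤ t) → (sup D f ∧ y) ≤ t
    sup-∧-least bound = x≤¬y∨z⇒x∧y≤z (sup-least λ x∈D → x∧y≤z⇒x≤¬y∨z (bound x∈D))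

    -- For monotone f and a lub u of D this says that f preserves that lub.
    record PreservesSup (D : Pred X (c ⊔ ℓ)) (u : X) (f : X → Carrier) : Set ℓ where
      constructor preservesSup
      field ≤-sup : f u ≤ sup D f

    preservesSup-∨ : ∀ {D u f g} → PreservesSup D u f → PreservesSup D u g →
                     PreservesSup D u (λ x → f x ∨ g x)
    preservesSup-∨ (preservesSup fu≤) (preservesSup gu≤) = preservesSup $
      ≤-trans (∨-monotonic fu≤ gu≤) (∨-least (sup-mono λ _ → x≤x∨y _ _) (sup-mono λ _ → y≤x∨y _ _))

    preservesSup-≈ : ∀ {D u f g} → (∀ x → f x ≈ g x) → PreservesSup D u f → PreservesSup D u g
    preservesSup-≈ {u = u} f≈g (preservesSup fu≤) = preservesSup $
      ≤-trans (≤-reflexive (sym (f≈g u))) (≤-trans fu≤ (sup-mono λ {x} _ → ≤-reflexive (f≈g x)))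

  pos neg : L⋈L → Carrier
  pos x = proj₁ (proj₁ x)
  neg x = ¬ proj₂ (proj₁ x)

  pos≤neg : ∀ x → pos x ≤ neg x
  pos≤neg x = x∧y≈⊥⇒x≤¬y (proj₂ x)

  ≤⋈-isPartialOrder : IsPartialOrder _≈⋈_ _≤⋈_
  ≤⋈-isPartialOrder = record
    { isPreorder = record
      { isEquivalence = record
        { refl  = refl , refl
        ; sym   = λ (p≈r , q≈s) → sym p≈r , sym q≈s
        ; trans = λ (p≈r , q≈s) (r≈t , s≈u) → trans p≈r r≈t , trans q≈s s≈u
        }
      ; reflexive = λ (p≈r , q≈s) → ≤-reflexive p≈r , ≤-reflexive (sym q≈s)
      ; trans     = λ (p≤r , s≤q) (r≤t , u≤s) → ≤-trans p≤r r≤t , ≤-trans u≤s s≤q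
      }
    ; antisym = λ (p≤r , s≤q) (r≤p , q≤s) → ≤-antisym p≤r r≤p , ≤-antisym q≤s s≤q
    }

  module _ {X : Set (c ⊔ ℓ)} where

    ⋁⋈ : Pred X (c ⊔ ℓ) → (X → L⋈L) → L⋈L
    ⋁⋈ D f = (sup D (pos ∘ f) , ¬ sup D (neg ∘ f)) , x≤¬y⇒x∧y≈⊥ (begin
      sup D (pos ∘ f)    ≤⟨ sup-mono (λ {x} _ → pos≤neg (f x)) ⟩
      sup D (neg ∘ f)    ≈⟨ ¬-involutive _ ⟨
      ¬ ¬ sup D (neg ∘ f) ∎)

    ⋁⋈-ub : ∀ {D} f {x} → x ∈ D → f x ≤⋈ ⋁⋈ D f
    ⋁⋈-ub f x∈D = sup-ub x∈D , ¬x≤y⇒¬y≤x (sup-ub x∈D)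

    ⋁⋈-least : ∀ {D} f {w} → (∀ {x} → x ∈ D → f x ≤⋈ w) → ⋁⋈ D f ≤⋈ w
    ⋁⋈-least f w-ub = sup-least (λ x∈D → proj₁ (w-ub x∈D)) ,
                    x≤¬y⇒y≤¬x (sup-least λ x∈D → ¬-antitone (proj₂ (w-ub x∈D)))

    neg-⋁⋈ : ∀ D f → neg (⋁⋈ D f) ≤ sup D (neg ∘ f)
    neg-⋁⋈ _ _ = ≤-reflexive (¬-involutive _)

  module DirectedSups {X : Set (c ⊔ ℓ)} {r} (_≼_ : Rel X r) where

    sup-∧-sup : ∀ {D f g} → Directed _≼_ D → Monotone _≼_ _≤_ f → Monotone _≼_ _≤_ g →
                (sup D f ∧ sup D g) ≤ sup D (λ x → f x ∧ g x)
    sup-∧-sup {D} {f} {g} (_ , directed) f-mono g-mono =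
      sup-∧-least λ x∈D → ≤-trans (≤-reflexive (∧-comm _ _)) (sup-∧-least λ y∈D → below y∈D x∈D)
      where
      below : ∀ {x y} → y ∈ D → x ∈ D → (g y ∧ f x) ≤ sup D (λ x → f x ∧ g x)
      below {x} {y} y∈D x∈D with directed x∈D y∈D
      ... | z , z∈D , x≼z , y≼z = begin
        g y ∧ f x  ≤⟨ ∧-monotonic (g-mono y≼z) (f-mono x≼z) ⟩
        g z ∧ f z  ≈⟨ ∧-comm (g z) (f z) ⟩
        f z ∧ g z  ≤⟨ sup-ub z∈D ⟩
        _          ∎

    preservesSup-∧ : ∀ {D u f g} → Directed _≼_ D → Monotone _≼_ _≤_ f → Monotone _≼_ _≤_ g →
                     PreservesSup D u f → PreservesSup D u g → PreservesSup D u (λ x → f x ∧ g x)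
    preservesSup-∧ directed f-mono g-mono (preservesSup fu≤) (preservesSup gu≤) = preservesSup $
      ≤-trans (∧-monotonic fu≤ gu≤) (sup-∧-sup directed f-mono g-mono)

    continuous-to-L : ∀ f → Monotone _≼_ _≤_ f →
                      (∀ {D} → Directed _≼_ D → ∀ {u} → IsLub _≼_ D u → PreservesSup D u f) →
                      Continuous _≼_ _≤_ (c ⊔ ℓ) f
    continuous-to-L f f-mono preserves = f-mono , λ D directed u lub →
      (λ d∈D → f-mono (proj₁ lub d∈D)) ,
      λ w w-ub → ≤-trans (PreservesSup.≤-sup (preserves directed lub)) (sup-least w-ub)

    preservesSup-coordinate : ∀ {D u f} → IsLub _≼_ D u → ∀ U → IsUpperBound _≼_ D U →
                              Monotone _≼_ _≤_ f → f U ≤ sup D f → PreservesSup D u f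
    preservesSup-coordinate lub U U-ub f-mono fU≤ =
      preservesSup $ ≤-trans (f-mono (proj₂ lub U U-ub)) fU≤

    continuous-to-L⋈L : ∀ f → Monotone _≼_ _≤⋈_ f →
                        (∀ {D} → Directed _≼_ D → ∀ {u} → IsLub _≼_ D u →
                          PreservesSup D u (pos ∘ f) × PreservesSup D u (neg ∘ f)) →
                        Continuous _≼_ _≤⋈_ (c ⊔ ℓ) f
    continuous-to-L⋈L f f-mono preserves = f-mono , λ D directed u lub →
      let preservesSup pos-preserved , preservesSup neg-preserved = preserves directed lub in
      (λ d∈D → f-mono (proj₁ lub d∈D)) ,
      λ w w-ub → ≤-trans pos-preserved (sup-least λ d∈D → proj₁ (w-ub d∈D)) ,
                 ¬x≤¬y⇒y≤x (≤-trans neg-preserved (sup-least λ d∈D → ¬-antitone (proj₂ (w-ub d∈D))))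

  ⊕-monotone : Monotone (_≤_ ×ᵣ _≤⋈_) _≤_ (uncurry _⊕⋈_)
  ⊕-monotone (a≤b , p≤r , s≤q) = ∧-monotonic (∨-monotonic a≤b p≤r) (¬-antitone s≤q)

  ⊕-continuous : Continuous (_≤_ ×ᵣ _≤⋈_) _≤_ (c ⊔ ℓ) (uncurry _⊕⋈_)
  ⊕-continuous = continuous-to-L (uncurry _⊕⋈_) (λ {x} {y} → ⊕-monotone {x} {y}) preserves
    where
    open DirectedSups (_≤_ ×ᵣ _≤⋈_)

    preserves : ∀ {D} → Directed (_≤_ ×ᵣ _≤⋈_) D → ∀ {u} → IsLub (_≤_ ×ᵣ _≤⋈_) D u →
                PreservesSup D u (uncurry _⊕⋈_)
    preserves {D} directed {u} lub =
      preservesSup-∧ directed (λ (a≤b , p≤r , _) → ∨-monotonic a≤b p≤r) (λ (_ , _ , s≤q) → ¬-antitone s≤q)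
        (preservesSup-∨ a p) n
      where
      U : Carrier × L⋈L
      U = sup D proj₁ , ⋁⋈ D proj₂

      U-ub : IsUpperBound (_≤_ ×ᵣ _≤⋈_) D U
      U-ub x∈D = sup-ub x∈D , ⋁⋈-ub proj₂ x∈D

      a : PreservesSup D u proj₁
      a = preservesSup-coordinate lub U U-ub (λ (a≤b , _) → a≤b) ≤-refl

      p : PreservesSup D u (pos ∘ proj₂)
      p = preservesSup-coordinate lub U U-ub (λ (_ , p≤r , _) → p≤r) ≤-refl

      n : PreservesSup D u (neg ∘ proj₂)
      n = preservesSup-coordinate lub U U-ub (λ (_ , _ , s≤q) → ¬-antitone s≤q)
            (neg-⋁⋈ D proj₂)

  ⋈-closed : ⋈-Closed
  ⋈-closed x@((_ , q) , _) y@((r , s) , _) = x≤¬y⇒x∧y≈⊥ (begin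
    (pos x ∧ neg y) ∨ pos y  ≤⟨ ∨-least (∧-monotonic (≤-trans (pos≤neg x) (x≤x∨y _ _)) ≤-refl)
                                        (∧-greatest (y≤x∨y _ _) (pos≤neg y)) ⟩
    (neg x ∨ pos y) ∧ neg y  ≈⟨ ¬[x∧¬y∨z]≈[¬x∨y]∧¬z q r s ⟨
    ¬ ((q ∧ ¬ r) ∨ s)        ∎)

  ⋈-monotone : Monotone (_≤⋈_ ×ᵣ _≤⋈_) _≤⋈_ (bowtie ⋈-closed)
  ⋈-monotone ((p≤p′ , q′≤q) , (r≤r′ , s′≤s)) =
    ∨-monotonic (∧-monotonic p≤p′ (¬-antitone s′≤s)) r≤r′ ,
    ∨-monotonic (∧-monotonic q′≤q (¬-antitone r≤r′)) s′≤s

  neg-bowtie : ∀ xy → neg (bowtie ⋈-closed xy) ≈ ((neg (proj₁ xy) ∨ pos (proj₂ xy)) ∧ neg (proj₂ xy))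
  neg-bowtie (((_ , q) , _) , ((r , s) , _)) = ¬[x∧¬y∨z]≈[¬x∨y]∧¬z q r s

  ⋈-continuous : Continuous (_≤⋈_ ×ᵣ _≤⋈_) _≤⋈_ (c ⊔ ℓ) (bowtie ⋈-closed)
  ⋈-continuous = continuous-to-L⋈L (bowtie ⋈-closed) (λ {x} {y} → ⋈-monotone {x} {y}) preserves
    where
    open DirectedSups (_≤⋈_ ×ᵣ _≤⋈_)

    preserves : ∀ {D} → Directed (_≤⋈_ ×ᵣ _≤⋈_) D → ∀ {u} → IsLub (_≤⋈_ ×ᵣ _≤⋈_) D u →
                PreservesSup D u (pos ∘ bowtie ⋈-closed) × PreservesSup D u (neg ∘ bowtie ⋈-closed)
    preserves {D} directed {u} lub =
      preservesSup-∨ (preservesSup-∧ directed (λ ((p≤r , _) , _) → p≤r) (λ (_ , _ , s≤q) → ¬-antitone s≤q)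
                                     p₁ n₂) p₂ ,
      preservesSup-≈ (λ xy → sym (neg-bowtie xy))
        (preservesSup-∧ directed (λ ((_ , s≤q) , p≤r , _) → ∨-monotonic (¬-antitone s≤q) p≤r)
                                 (λ (_ , _ , s≤q) → ¬-antitone s≤q)
                                 (preservesSup-∨ n₁ p₂) n₂)
      where
      U : L⋈L × L⋈L
      U = ⋁⋈ D proj₁ , ⋁⋈ D proj₂

      U-ub : IsUpperBound (_≤⋈_ ×ᵣ _≤⋈_) D U
      U-ub x∈D = ⋁⋈-ub proj₁ x∈D , ⋁⋈-ub proj₂ x∈D

      p₁ : PreservesSup D u (pos ∘ proj₁)
      p₁ = preservesSup-coordinate lub U U-ub (λ ((p≤r , _) , _) → p≤r) ≤-refl

      n₁ : PreservesSup D u (neg ∘ proj₁)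
      n₁ = preservesSup-coordinate lub U U-ub (λ ((_ , s≤q) , _) → ¬-antitone s≤q)
             (neg-⋁⋈ D proj₁)

      p₂ : PreservesSup D u (pos ∘ proj₂)
      p₂ = preservesSup-coordinate lub U U-ub (λ (_ , p≤r , _) → p≤r) ≤-refl

      n₂ : PreservesSup D u (neg ∘ proj₂)
      n₂ = preservesSup-coordinate lub U U-ub (λ (_ , _ , s≤q) → ¬-antitone s≤q)
             (neg-⋁⋈ D proj₂)

mainTheorem15 : ∀ {c ℓ : Level} (L : CompleteBooleanAlgebra c ℓ) →
    let open CompleteBooleanAlgebra L
        open Bowtie L
    in IsPartialOrder _≈_ _≤_
       × IsPartialOrder _≈⋈_ _≤⋈_
       × DirectedComplete _≤_ (c ⊔ ℓ)
       × DirectedComplete _≤⋈_ (c ⊔ ℓ)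
       × Continuous (_≤_ ×ᵣ _≤⋈_) _≤_ (c ⊔ ℓ) (uncurry _⊕⋈_)
       × Σ ⋈-Closed (λ cl → Continuous (_≤⋈_ ×ᵣ _≤⋈_) _≤⋈_ (c ⊔ ℓ) (bowtie cl))
mainTheorem15 L =
  isPartialOrder ,
  ≤⋈-isPartialOrder ,
  (λ D _ → ⋁ D , ⋁-isLub D) ,
  (λ D _ → ⋁⋈ D id , ⋁⋈-ub id , λ v → ⋁⋈-least id {v}) ,
  ⊕-continuous ,
  ⋈-closed , ⋈-continuous
  where
  open CompleteBooleanAlgebra L using (⋁; ⋁-isLub; booleanAlgebra)
  open BooleanOrder booleanAlgebra using (isPartialOrder)
  open Continuity L
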